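{- Let $M \in \mathrm{M}_2(\mathbb{Z})$ be a $2\times 2$ matrix with integer entries. If, for every pair of coprime integers $a$ and $b$, the two entries of the column vector $M (a, b)^{T}$ are coprime, then $M \in \operatorname{GL}(2,\mathbb{Z})$.
   Context: $\mathrm{M}_2(\mathbb{Z})$ denotes the set of $2\times 2$ integer matrices and $\operatorname{GL}(2,\mathbb{Z})$ the group of integer $2\times 2$ matrices with determinant $\pm 1$. -}

module Defs where

open import Data.Integer using (ℤ; _+_; _-_; _*_; -_; +_; 1ℤ)
open import Data.Integer.Coprimality using (Coprime)
open import Data.Fin using (Fin; zero; suc)
open import Data.Sum using (_⊎_)
open import Relation.Binary.PropositionalEquality using (_≡_)

-- 2×2 integer matrices M₂(ℤ), indexed by (row, column)
M₂ℤ : Set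
M₂ℤ = Fin 2 → Fin 2 → ℤ

det : M₂ℤ → ℤ
det M = M zero zero * M (suc zero) (suc zero) - M zero (suc zero) * M (suc zero) zero

mulVec₀ : M₂ℤ → ℤ → ℤ → ℤ
mulVec₀ M a b = M zero zero * a + M zero (suc zero) * b

mulVec₁ : M₂ℤ → ℤ → ℤ → ℤ
mulVec₁ M a b = M (suc zero) zero * a + M (suc zero) (suc zero) * b

InGL2ℤ : M₂ℤ → Set
InGL2ℤ M = det M ≡ 1ℤ ⊎ det M ≡ - 1ℤ

-- Split the bottom row of M = [[p, q], [r, s]] as (r, s) = g (r′, s′) with r′ x + s′ y = 1.
-- The primitive vector (s′, -r′) is sent to (e, 0), where e = p s′ - q r′, so e = ±1;
-- shearing (x, y) along (s′, -r′) gives a primitive vector sent to (0, g), so g = ±1.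
-- Hence det M = g e = ±1.
module Submission where

open import Defs
open import Data.Integer
  using (ℤ; +_; -[1+_]; +[1+_]; _+_; _-_; _*_; -_; ∣_∣; 1ℤ; 0ℤ; _/_; _%_)
open import Data.Integer.Coprimality using (Coprime)
import Data.Integer.Coprimality as Coprime
open import Data.Integer.DivMod using (a≡a%n+[a/n]*n; n%d<d)
open import Data.Integer.Divisibility.Signed using (_∣_; ∣ᵤ⇒∣; ∣⇒∣ᵤ; ∣m∣n⇒∣m+n; ∣n⇒∣m*n)
open import Data.Integer.Tactic.RingSolver using (solve)
import Data.Nat as ℕ
import Data.Nat.Properties as ℕ
import Data.Nat.Divisibility as ℕ
open import Data.Integer.Properties using (i≡j⇒i-j≡0; *-identityʳ)
open import Data.Fin using (zero; suc)
open import Data.List using (_∷_; [])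
open import Data.Product using (_,_)
open import Data.Sum using (_⊎_; inj₁; inj₂)
open import Relation.Binary.PropositionalEquality
  using (_≡_; refl; sym; trans; cong; cong₂; subst; subst₂; module ≡-Reasoning)

open ≡-Reasoning

IsUnit : ℤ → Set
IsUnit i = i ≡ 1ℤ ⊎ i ≡ - 1ℤ

∣i∣≡1⇒IsUnit : ∀ i → ∣ i ∣ ≡ 1 → IsUnit i
∣i∣≡1⇒IsUnit (+ .1)    refl = inj₁ refl
∣i∣≡1⇒IsUnit -[1+ 0 ] refl = inj₂ refl

IsUnit-* : ∀ {i j} → IsUnit i → IsUnit j → IsUnit (i * j)
IsUnit-* (inj₁ refl) (inj₁ refl) = inj₁ refl
IsUnit-* (inj₁ refl) (inj₂ refl) = inj₂ refl
IsUnit-* (inj₂ refl) (inj₁ refl) = inj₂ refl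
IsUnit-* (inj₂ refl) (inj₂ refl) = inj₁ refl

IsUnit⇒i*j*i≡j : ∀ {i} → IsUnit i → ∀ j → i * j * i ≡ j
IsUnit⇒i*j*i≡j (inj₁ refl) j = solve (j ∷ [])
IsUnit⇒i*j*i≡j (inj₂ refl) j = solve (j ∷ [])

Bézout⇒coprime : ∀ {a b} u v → u * a + v * b ≡ 1ℤ → Coprime a b
Bézout⇒coprime {a} {b} u v eq {d} (d∣a , d∣b) =
  ℕ.∣1⇒≡1 (subst (λ z → d ℕ.∣ ∣ z ∣) eq (∣⇒∣ᵤ {+ d} d∣ua+vb))
  where
  d∣ua+vb : + d ∣ u * a + v * b
  d∣ua+vb = ∣m∣n⇒∣m+n (∣n⇒∣m*n u (∣ᵤ⇒∣ {+ d} {a} d∣a)) (∣n⇒∣m*n v (∣ᵤ⇒∣ {+ d} {b} d∣b))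

coprime[i,0]⇒IsUnit : ∀ {i} → Coprime i 0ℤ → IsUnit i
coprime[i,0]⇒IsUnit {i} c = ∣i∣≡1⇒IsUnit i (c (ℕ.∣-refl , ℕ.divides 0 refl))

record PrimitiveFactorisation (r s : ℤ) : Set where
  constructor mkPrimitiveFactorisation
  field
    content r′ s′ x y : ℤ
    r≡ : r ≡ content * r′
    s≡ : s ≡ content * s′
    bézout : r′ * x + s′ * y ≡ 1ℤ

primitiveFactorisation[r,0] : ∀ r → PrimitiveFactorisation r 0ℤ
primitiveFactorisation[r,0] r = record
  { content = r ; r′ = 1ℤ ; s′ = 0ℤ ; x = 1ℤ ; y = 0ℤ
  ; r≡ = solve (r ∷ []) ; s≡ = solve (r ∷ []) ; bézout = refl }

primitiveFactorisation-step : ∀ {r s t} q → r ≡ t + q * s →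
  PrimitiveFactorisation s t → PrimitiveFactorisation r s
primitiveFactorisation-step {r} {s} {t} q r≡t+qs
  (mkPrimitiveFactorisation g r′ s′ x y s≡ t≡ bézout) = record
  { content = g ; r′ = q * r′ + s′ ; s′ = r′ ; x = y ; y = x - q * y
  ; r≡ = r≡′ ; s≡ = s≡ ; bézout = bézout′ }
  where
  r≡′ : r ≡ g * (q * r′ + s′)
  r≡′ = begin
    r                     ≡⟨ r≡t+qs ⟩
    t + q * s             ≡⟨ cong₂ (λ u v → u + q * v) t≡ s≡ ⟩
    g * s′ + q * (g * r′) ≡⟨ solve (g ∷ s′ ∷ q ∷ r′ ∷ []) ⟩
    g * (q * r′ + s′)     ∎
  bézout′ : (q * r′ + s′) * y + r′ * (x - q * y) ≡ 1ℤ
  bézout′ = begin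
    (q * r′ + s′) * y + r′ * (x - q * y) ≡⟨ solve (q ∷ r′ ∷ s′ ∷ x ∷ y ∷ []) ⟩
    r′ * x + s′ * y                      ≡⟨ bézout ⟩
    1ℤ                                   ∎

primitiveFactorisation-< : ∀ n r s → ∣ s ∣ ℕ.< n → PrimitiveFactorisation r s
primitiveFactorisation-< n r (+ 0) _ = primitiveFactorisation[r,0] r
primitiveFactorisation-< (ℕ.suc n) r s@(+[1+ _ ]) (ℕ.s≤s ∣s∣≤n) =
  primitiveFactorisation-step (r / s) (a≡a%n+[a/n]*n r s)
    (primitiveFactorisation-< n s (+ (r % s)) (ℕ.<-≤-trans (n%d<d r s) ∣s∣≤n))
primitiveFactorisation-< (ℕ.suc n) r s@(-[1+ _ ]) (ℕ.s≤s ∣s∣≤n) =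
  primitiveFactorisation-step (r / s) (a≡a%n+[a/n]*n r s)
    (primitiveFactorisation-< n s (+ (r % s)) (ℕ.<-≤-trans (n%d<d r s) ∣s∣≤n))

primitiveFactorisation : ∀ r s → PrimitiveFactorisation r s
primitiveFactorisation r s = primitiveFactorisation-< _ r s (ℕ.n<1+n ∣ s ∣)

shear-form : ∀ u v x y s′ r′ t →
  u * (x - t * s′) + v * (y + t * r′) ≡ u * x + v * y - t * (u * s′ - v * r′)
shear-form u v x y s′ r′ t = solve (u ∷ v ∷ x ∷ y ∷ s′ ∷ r′ ∷ t ∷ [])

shear-bézout : ∀ r′ s′ x y t → r′ * x + s′ * y ≡ 1ℤ →
  r′ * (x - t * s′) + s′ * (y + t * r′) ≡ 1ℤ
shear-bézout r′ s′ x y t bézout = begin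
  r′ * (x - t * s′) + s′ * (y + t * r′) ≡⟨ solve (r′ ∷ s′ ∷ x ∷ y ∷ t ∷ []) ⟩
  r′ * x + s′ * y                       ≡⟨ bézout ⟩
  1ℤ                                    ∎

module CoprimalityPreserving (p q r s : ℤ)
  (H : ∀ a b → Coprime a b → Coprime (p * a + q * b) (r * a + s * b))
  (g r′ s′ x y : ℤ) (r≡ : r ≡ g * r′) (s≡ : s ≡ g * s′) (bézout : r′ * x + s′ * y ≡ 1ℤ)
  where

  bottom≡content* : ∀ a b → r * a + s * b ≡ g * (r′ * a + s′ * b)
  bottom≡content* a b = begin
    r * a + s * b           ≡⟨ cong₂ (λ u v → u * a + v * b) r≡ s≡ ⟩
    g * r′ * a + g * s′ * b ≡⟨ solve (g ∷ r′ ∷ a ∷ s′ ∷ b ∷ []) ⟩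
    g * (r′ * a + s′ * b)   ∎

  e : ℤ
  e = p * s′ - q * r′

  det≡content*e : p * s - q * r ≡ g * e
  det≡content*e = begin
    p * s - q * r               ≡⟨ cong₂ (λ u v → p * u - q * v) s≡ r≡ ⟩
    p * (g * s′) - q * (g * r′) ≡⟨ solve (p ∷ q ∷ g ∷ s′ ∷ r′ ∷ []) ⟩
    g * (p * s′ - q * r′)       ∎

  e-IsUnit : IsUnit e
  e-IsUnit = coprime[i,0]⇒IsUnit (subst₂ Coprime top≡e bottom≡0 (H s′ (- r′) coprime))
    where
    coprime : Coprime s′ (- r′)
    coprime = Bézout⇒coprime {s′} { - r′} y (- x) (begin
      y * s′ + - x * - r′ ≡⟨ solve (y ∷ s′ ∷ x ∷ r′ ∷ []) ⟩
      r′ * x + s′ * y     ≡⟨ bézout ⟩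
      1ℤ                  ∎)
    top≡e : p * s′ + q * - r′ ≡ p * s′ - q * r′
    top≡e = solve (p ∷ s′ ∷ q ∷ r′ ∷ [])
    bottom≡0 : r * s′ + s * - r′ ≡ 0ℤ
    bottom≡0 = trans (bottom≡content* s′ (- r′)) (solve (g ∷ r′ ∷ s′ ∷ []))

  content-IsUnit : IsUnit g
  content-IsUnit =
    coprime[i,0]⇒IsUnit (Coprime.sym {0ℤ} {g} (subst₂ Coprime top≡0 bottom≡g (H a b coprime)))
    where
    -- shear (x, y) along (s′, -r′) by t = e w, which kills the top entry since e⁻¹ = e
    w t a b : ℤ
    w = p * x + q * y
    t = e * w
    a = x - t * s′
    b = y + t * r′
    coprime : Coprime a b
    coprime = Bézout⇒coprime {a} {b} r′ s′ (shear-bézout r′ s′ x y t bézout)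
    top≡0 : p * a + q * b ≡ 0ℤ
    top≡0 = trans (shear-form p q x y s′ r′ t) (i≡j⇒i-j≡0 (sym (IsUnit⇒i*j*i≡j e-IsUnit w)))
    bottom≡g : r * a + s * b ≡ g
    bottom≡g = begin
      r * a + s * b         ≡⟨ bottom≡content* a b ⟩
      g * (r′ * a + s′ * b) ≡⟨ cong (g *_) (shear-bézout r′ s′ x y t bézout) ⟩
      g * 1ℤ                ≡⟨ *-identityʳ g ⟩
      g                     ∎

lemma2p6 : (M : M₂ℤ) →
    ((a b : ℤ) → Coprime a b → Coprime (mulVec₀ M a b) (mulVec₁ M a b)) →
    InGL2ℤ M
lemma2p6 M H = subst IsUnit (sym det≡content*e) (IsUnit-* content-IsUnit e-IsUnit)
  where
  p q r s : ℤ
  p = M zero zero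
  q = M zero (suc zero)
  r = M (suc zero) zero
  s = M (suc zero) (suc zero)
  open PrimitiveFactorisation (primitiveFactorisation r s)
  open CoprimalityPreserving p q r s H content r′ s′ x y r≡ s≡ bézout
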